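{- Let $k\in\mathbb{Z}_{>0}$ and $a\in\frac k2+\mathbb{Z}$ with $a\ge0$. For $N\ge1$ let $\widetilde{CM}^{N}_{k,a}(q):=\sum_w q^{a_M(w)}$, the sum over all $(k,a)$-Motzkin paths $w$ of length $N$, and set $$CM^{2n+1}_{k,a}(q):=q^{\frac k2 n(n+1)+an(2n+1)}\,\widetilde{CM}^{2n+1}_{k,a}(q^{ -1}).$$ Then $\lim_{n\to\infty}CM^{2n+1}_{k,a}(q)=C\Psi_{k,a}(q)$ (as power series in $q$, coefficientwise).
   Context: An $a$-shifted Motzkin path of length $N$ and rank $\frac k2$ is a lattice path from $(0,0)$ to $(N,a(N-1))$ consisting of $N$ steps of the form $(1,j)$ with $j\in\{a-\frac k2,a-\frac k2+1,\dots,a+\frac k2\}$, which never goes below the $x$-axis. A $(k,a)$-Motzkin path is such a path in which each step $(1,j)$ is additionally colored by a subset $T\subseteq\{1,\dots,k\}$ with $\#T=\frac k2-a+j$ (distinct colorings give distinct paths). $a_M(w)$ is the area of the region between the path (as a piecewise linear graph) and the $x$-axis. Colored integers: pairs $m_j$ with $m\in\mathbb{Z}_{\ge0}$ and color $j\in\{1,\dots,k\}$, ordered lexicographically ($m_j<n_\ell$ iff $m<n$, or $m=n$ and $j<\ell$). A $(k,a)$-colored F-partition is a two-rowed array $\begin{pmatrix}a_1&\cdots&a_r\\ b_1&\cdots&b_s\end{pmatrix}$ of colored nonnegative integers, each row strictly decreasing, with $r-s=a-\frac k2$; its weight is $r+\sum a_\ell+\sum b_j$. $C\Psi_{k,a}(q):=\sum_{n\ge0}c\psi_{k,a}(n)q^n$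 where $c\psi_{k,a}(n)$ counts such arrays of weight $n$. -}

module Defs where

open import Data.Nat using (ℕ; zero; suc; _+_; _*_; _∸_; _<_)
open import Data.Integer as ℤ using (ℤ; +_; _-_; _≤_)
open import Data.Fin using (Fin)
import Data.Fin as Fin
open import Data.Fin.Subset using (Subset; ∣_∣)
open import Data.Vec using (Vec; []; _∷_)
open import Data.Vec.Relation.Unary.All using (All)
open import Data.List using (List; length; map)
open import Data.Nat.ListAction using (sum)
open import Data.List.Relation.Unary.Linked using (Linked)
open import Data.Product using (Σ; _×_; proj₁)
open import Data.Sum using (_⊎_)
open import Relation.Binary.PropositionalEquality using (_≡_)

-- The parameter a ∈ k/2 + ℤ, a ≥ 0, is encoded by A = 2a ∈ ℕ
-- (with A ≡ k mod 2).  All heights are stored DOUBLED (H = 2h) and the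
-- area QUADRUPLED, so that everything is an integer.

-- A colored step of a (k,a)-Motzkin path is a step (1,j) together with a
-- subset T ⊆ {1,…,k} with #T = k/2 - a + j; the pair is determined by T,
-- since j = #T + a - k/2.  So a step is represented by T : Subset k.
-- doubled height increment 2j = 2#T + A - k
step2 : (k A : ℕ) → Subset k → ℤ
step2 k A T = + (2 * ∣ T ∣ + A) - + k

heights2 : ∀ {k N} → (A : ℕ) → ℤ → Vec (Subset k) N → Vec ℤ N
heights2 A h [] = []
heights2 {k} A h (T ∷ w) = (h ℤ.+ step2 k A T) ∷ heights2 A (h ℤ.+ step2 k A T) w

end2 : ∀ {k N} → (A : ℕ) → ℤ → Vec (Subset k) N → ℤ
end2 A h [] = h
end2 {k} A h (T ∷ w) = end2 A (h ℤ.+ step2 k A T) w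

-- 4 × (area under the piecewise linear path) = Σ_i (H_{i-1} + H_i)
-- (trapezoid areas (h_{i-1}+h_i)/2; the path never goes below the axis)
area4 : ∀ {k N} → (A : ℕ) → ℤ → Vec (Subset k) N → ℤ
area4 A h [] = + 0
area4 {k} A h (T ∷ w) = (h ℤ.+ (h ℤ.+ step2 k A T)) ℤ.+ area4 A (h ℤ.+ step2 k A T) w

IsMotzkin : (k A N : ℕ) → Vec (Subset k) N → Set
IsMotzkin k A N w = All (λ H → + 0 ≤ H) (heights2 A (+ 0) w)
                    × end2 A (+ 0) w ≡ + (A * (N ∸ 1))

-- The paths contributing to the coefficient of q^m in
--   CM^{2n+1}_{k,a}(q) = q^{k/2 n(n+1) + a n(2n+1)} · Σ_w q^{-a_M(w)},
-- i.e. those w with  k/2 n(n+1) + a n(2n+1) - a_M(w) = m  (multiplied by 4).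
CMCoeffPaths : (k A n m : ℕ) → Set
CMCoeffPaths k A n m =
  Σ (Vec (Subset k) (suc (2 * n)))
    (λ w → IsMotzkin k A (suc (2 * n)) w
         × (+ (2 * k * n * (n + 1) + 2 * A * n * (2 * n + 1)) - area4 A (+ 0) w
             ≡ + (4 * m)))

ColInt : ℕ → Set
ColInt k = ℕ × Fin k

_<c_ : ∀ {k} → ColInt k → ColInt k → Set
(m Data.Product., j) <c (n Data.Product., l) = m < n ⊎ (m ≡ n × j Fin.< l)

StrictDec : ∀ {k} → List (ColInt k) → Set
StrictDec = Linked (λ x y → y <c x)

-- (k,a)-colored F-partitions of weight n; r - s = a - k/2 is encoded as
-- 2r + k = A + 2s.
record CFPart (k A n : ℕ) : Set where
  field
    top    : List (ColInt k)
    bottom : List (ColInt k)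
    topDec : StrictDec top
    botDec : StrictDec bottom
    rowLen : 2 * length top + k ≡ A + 2 * length bottom
    weight : length top + sum (map proj₁ top) + sum (map proj₁ bottom) ≡ n

module Submission where

-- Record an F-partition by two tables of color sets indexed by part value: row v of the
-- top (bottom) table holds the colors j such that v_j is in the top (bottom) row. For
-- n ≥ 3m a partition of weight m corresponds to the path of length 2n + 1 whose first n
-- steps carry the complements of the top rows (value n − 1 first) and whose last n + 1
-- steps carry the bottom rows (value 0 first). The path ends at height a(N − 1) exactly
-- when r − s = a − k/2, and then k/2 n(n + 1) + a n(2n + 1) − a_M equals the weight; both
-- are polynomial identities in the row sizes and label sums. Conversely every path splits
-- this way, and all of it stays above the axis: a part of value v costs at least v, so
-- only rows of value at most m are nonempty. The first half therefore climbs by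
-- k/2 + a ≥ 1 per step until its last m steps, which lose at most r ≤ m in total, and in
-- the second half every height exceeds what the few nonempty rows still to come can
-- subtract from the final height.

open import Axiom.UniquenessOfIdentityProofs using (module Decidable⇒UIP)
open import Data.Bool using (Bool; true; false; not)
open import Data.Bool.Properties using (⇔→≡; not-involutive)
open import Data.Empty using (⊥-elim)
open import Data.Fin as Fin using (Fin; zero; suc)
open import Data.Fin.Properties using (2↔Bool; 1↔⊤; 0↔⊥; +↔⊎; *↔×)
open import Data.Fin.Subset using (Subset; ∣_∣; ∁)
open import Data.Fin.Subset.Properties using (∣p∣≤n; ∣∁p∣≡n∸∣p∣)
open import Data.Integer as ℤ using (ℤ; +_; +≤+)
import Data.Integer.Properties as ℤ
import Data.Integer.Tactic.RingSolver as ℤ-Solver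
open import Data.List using (List; []; _∷_; _++_; map; length)
import Data.List.Properties as List
open import Data.List.Membership.Propositional using (_∈_)
open import Data.List.Membership.Propositional.Properties
  using (∈-map⁺; ∈-map⁻; ∈-++⁺ˡ; ∈-++⁺ʳ; ∈-++⁻)
import Data.List.Relation.Unary.All as ListAll
open import Data.List.Relation.Unary.Any using (here; there)
open import Data.List.Relation.Unary.Linked as Linked using (Linked; []; [-]; _∷_)
import Data.List.Relation.Unary.Linked.Properties as Linked
open import Data.Nat as ℕ using (ℕ; zero; suc; _+_; _*_; _∸_; _%_; _<_; _≤_; z≤n; s≤s)
import Data.Nat.Properties as ℕ
open import Data.Nat.ListAction using (sum)
import Data.Nat.ListAction.Properties as Sum
open import Data.Nat.Tactic.RingSolver using (solve-∀)
open import Data.Product using (Σ; _×_; _,_; proj₁; proj₂; map₁)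
open import Data.Product.Function.Dependent.Propositional using (Σ-↔)
open import Data.Product.Function.NonDependent.Propositional using (_×-↔_)
import Data.Product.Properties as Product
open import Data.Sum using (_⊎_; inj₁; inj₂)
open import Data.Sum.Function.Propositional using (_⊎-↔_)
open import Data.Vec as Vec using (Vec; []; _∷_; _∷ʳ_; lookup; tabulate; reverse)
import Data.Vec.Properties as Vec
open import Data.Vec.Relation.Unary.All as All using (All; []; _∷_)
open import Defs
open import Function.Base using (_∘_)
open import Function.Bundles using (_⇔_; mk⇔; Equivalence; _↔_; mk↔ₛ′; Inverse)
open import Function.Construct.Composition using () renaming (equivalence to ⇔-trans)
open import Function.Construct.Symmetry using (⇔-sym)
open import Function.Nary.NonDependent using (congₙ)
open import Function.Properties.Inverse using (↔-sym; ↔-trans; ↔-refl)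
open import Relation.Binary.PropositionalEquality
  using (_≡_; refl; sym; trans; cong; cong₂; subst; subst₂; module ≡-Reasoning)
open import Relation.Nullary using (¬_; Dec; yes; no; does)
open import Relation.Nullary.Decidable using (_×-dec_; True-↔)
open import Relation.Nullary.Irrelevant using (Irrelevant)

open Equivalence using (to; from)

linked-++ : ∀ {X : Set} {R : X → X → Set} {xs ys : List X} →
  Linked R xs → Linked R ys → (∀ {x y} → x ∈ xs → y ∈ ys → R x y) →
  Linked R (xs ++ ys)
linked-++               []        Rys Rxy = Rys
linked-++ {ys = []}     [-]       Rys Rxy = [-]
linked-++ {ys = y ∷ ys} [-]       Rys Rxy = Rxy (here refl) (here refl) ∷ Rys
linked-++               (r ∷ Rxs) Rys Rxy = r ∷ linked-++ Rxs Rys (λ x∈ y∈ → Rxy (there x∈) y∈)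

does⇔ : ∀ {P : Set} (P? : Dec P) → does P? ≡ true ⇔ P
does⇔ (yes p) = mk⇔ (λ _ → p) (λ _ → refl)
does⇔ (no ¬p) = mk⇔ (λ ()) (λ p → ⊥-elim (¬p p))

join : ∀ {X : Set} {n m} → Vec X n → Vec X (suc m) → Vec X (suc (n + m))
join []       ys = ys
join (x ∷ xs) ys = x ∷ join xs ys

split : ∀ {X : Set} n {m} → Vec X (suc (n + m)) → Vec X n × Vec X (suc m)
split zero    w       = [] , w
split (suc n) (x ∷ w) = map₁ (x ∷_) (split n w)

split-join : ∀ {X : Set} {n m} (xs : Vec X n) (ys : Vec X (suc m)) → split n (join xs ys) ≡ (xs , ys)
split-join []       ys = refl
split-join (x ∷ xs) ys = cong (map₁ (x ∷_)) (split-join xs ys)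

join-split : ∀ {X : Set} n {m} (w : Vec X (suc (n + m))) →
  join (proj₁ (split n w)) (proj₂ (split n w)) ≡ w
join-split zero    w       = refl
join-split (suc n) (x ∷ w) = cong (x ∷_) (join-split n w)

m+q≡n+p⇒[m≡n⇔q≡p] : ∀ {m n p q} → m + q ≡ n + p → (m ≡ n ⇔ q ≡ p)
m+q≡n+p⇒[m≡n⇔q≡p] {m} {n} {p} {q} e = mk⇔
  (λ { refl → ℕ.+-cancelˡ-≡ m q p e })
  (λ { refl → ℕ.+-cancelʳ-≡ q m n e })

cancel-combination : ∀ {m n p q} → m + p ≡ n + q → p ≡ q → m ≡ n
cancel-combination {m} {n} {p} e refl = ℕ.+-cancelʳ-≡ p m n e

+m-+n≡+o⇔m≡o+n : ∀ {m n o} → + m ℤ.- + n ≡ + o ⇔ m ≡ o + n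
+m-+n≡+o⇔m≡o+n {m} {n} {o} = mk⇔
  (λ e → ℤ.+-injective (begin
     + m                     ≡⟨ sym (minus-plus (+ m) (+ n)) ⟩
     (+ m ℤ.- + n) ℤ.+ + n   ≡⟨ cong (ℤ._+ + n) e ⟩
     + o ℤ.+ + n             ≡⟨ sym (ℤ.pos-+ o n) ⟩
     + (o + n)               ∎))
  (λ { refl → trans (cong (ℤ._- + n) (ℤ.pos-+ o n)) (plus-minus (+ o) (+ n)) })
  where
  open ≡-Reasoning
  minus-plus : ∀ a b → (a ℤ.- b) ℤ.+ b ≡ a
  minus-plus = ℤ-Solver.solve-∀
  plus-minus : ∀ a b → (a ℤ.+ b) ℤ.- b ≡ a
  plus-minus = ℤ-Solver.solve-∀

m*n≤o<m⇒n≡0 : ∀ m n {o} → m * n ≤ o → o < m → n ≡ 0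
m*n≤o<m⇒n≡0 m zero    _      _   = refl
m*n≤o<m⇒n≡0 m (suc n) m*n≤o o<m =
  ⊥-elim (ℕ.<-irrefl refl (ℕ.<-≤-trans o<m (ℕ.≤-trans (ℕ.m≤m*n m (suc n)) m*n≤o)))

∣∁r∣+∣r∣≡k : ∀ {k} (r : Subset k) → ∣ ∁ r ∣ + ∣ r ∣ ≡ k
∣∁r∣+∣r∣≡k r = trans (cong (_+ ∣ r ∣) (∣∁p∣≡n∸∣p∣ r)) (ℕ.m∸n+n≡m (∣p∣≤n r))

∁-involutive : ∀ {k} (r : Subset k) → ∁ (∁ r) ≡ r
∁-involutive r = trans (sym (Vec.map-∘ not not r))
                       (trans (Vec.map-cong not-involutive r) (Vec.map-id r))

map-∁-involutive : ∀ {k B} (R : Vec (Subset k) B) → Vec.map ∁ (Vec.map ∁ R) ≡ R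
map-∁-involutive R = trans (sym (Vec.map-∘ ∁ ∁ R))
                           (trans (Vec.map-cong ∁-involutive R) (Vec.map-id R))

Finite : Set → Set
Finite X = Σ ℕ λ c → X ↔ Fin c

Bool-finite : Finite Bool
Bool-finite = 2 , ↔-sym 2↔Bool

Vec-finite : ∀ {X : Set} → Finite X → ∀ n → Finite (Vec X n)
Vec-finite _ zero = 1 , mk↔ₛ′ (λ _ → zero) (λ _ → []) (λ { zero → refl }) (λ { [] → refl })
Vec-finite {X} X-fin@(a , X↔a) (suc n) =
  let b , V↔b = Vec-finite X-fin n in
  a * b , ↔-trans uncons (↔-trans (X↔a ×-↔ V↔b) (↔-sym *↔×))
  where
  uncons : Vec X (suc n) ↔ (X × Vec X n)
  uncons = mk↔ₛ′ (λ { (x ∷ xs) → x , xs }) (λ (x , xs) → x ∷ xs) (λ _ → refl) (λ { (x ∷ xs) → refl })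

dec-finite : ∀ {Q : Set} → Dec Q → Irrelevant Q → Finite Q
dec-finite Q?@(yes _) Q-irr = 1 , ↔-trans (↔-sym (True-↔ Q? Q-irr)) (↔-sym 1↔⊤)
dec-finite Q?@(no _)  Q-irr = 0 , ↔-trans (↔-sym (True-↔ Q? Q-irr)) (↔-sym 0↔⊥)

Σ-Fin-finite : ∀ c (Q : Fin c → Set) → (∀ i → Dec (Q i)) → (∀ i → Irrelevant (Q i)) →
  Finite (Σ (Fin c) Q)
Σ-Fin-finite zero    Q Q? Q-irr = 0 , mk↔ₛ′ (λ ()) (λ ()) (λ ()) (λ ())
Σ-Fin-finite (suc c) Q Q? Q-irr =
  let a , head↔a = dec-finite (Q? zero) (Q-irr zero)
      b , tail↔b = Σ-Fin-finite c (Q ∘ suc) (Q? ∘ suc) (Q-irr ∘ suc)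
  in a + b , ↔-trans split-zero (↔-trans (head↔a ⊎-↔ tail↔b) (↔-sym +↔⊎))
  where
  split-zero : Σ (Fin (suc c)) Q ↔ (Q zero ⊎ Σ (Fin c) (Q ∘ suc))
  split-zero = mk↔ₛ′
    (λ { (zero , q) → inj₁ q ; (suc i , q) → inj₂ (i , q) })
    (λ { (inj₁ q) → zero , q ; (inj₂ (i , q)) → suc i , q })
    (λ { (inj₁ q) → refl ; (inj₂ (i , q)) → refl })
    (λ { (zero , q) → refl ; (suc i , q) → refl })

Σ-finite : ∀ {X : Set} → Finite X → (P : X → Set) → (∀ x → Dec (P x)) → (∀ x → Irrelevant (P x)) →
  Finite (Σ X P)
Σ-finite {X} (c , X↔c) P P? P-irr =
  let c′ , ΣP↔c′ = Σ-Fin-finite c (P ∘ from′) (P? ∘ from′) (P-irr ∘ from′)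
  in c′ , ↔-trans (↔-sym (Σ-↔ (↔-sym X↔c) ↔-refl)) ΣP↔c′
  where
  from′ : Fin c → X
  from′ = Inverse.from X↔c

module _ {k : ℕ} where

  <c-trans : {x y z : ColInt k} → x <c y → y <c z → x <c z
  <c-trans (inj₁ p)          (inj₁ q)          = inj₁ (ℕ.<-trans p q)
  <c-trans (inj₁ p)          (inj₂ (refl , q)) = inj₁ p
  <c-trans (inj₂ (refl , p)) (inj₁ q)          = inj₁ q
  <c-trans (inj₂ (refl , p)) (inj₂ (refl , q)) = inj₂ (refl , ℕ.<-trans p q)

  <c-irrefl : {x : ColInt k} → ¬ (x <c x)
  <c-irrefl (inj₁ p)       = ℕ.<-irrefl refl p
  <c-irrefl (inj₂ (_ , q)) = ℕ.<-irrefl refl q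

  <c-irrelevant : {x y : ColInt k} (p q : x <c y) → p ≡ q
  <c-irrelevant (inj₁ p)          (inj₁ q)          = cong inj₁ (ℕ.<-irrelevant p q)
  <c-irrelevant (inj₁ p)          (inj₂ (refl , q)) = ⊥-elim (ℕ.<-irrefl refl p)
  <c-irrelevant (inj₂ (refl , p)) (inj₁ q)          = ⊥-elim (ℕ.<-irrefl refl q)
  <c-irrelevant (inj₂ (e , p))    (inj₂ (e′ , q))   =
    cong₂ (λ e p → inj₂ (e , p)) (ℕ.≡-irrelevant e e′) (ℕ.<-irrelevant p q)

  strictDec-irrelevant : {xs : List (ColInt k)} (p q : StrictDec xs) → p ≡ q
  strictDec-irrelevant = Linked.irrelevant <c-irrelevant

  head-dominates : ∀ {x z} {xs : List (ColInt k)} → StrictDec (x ∷ xs) → z ∈ xs → z <c x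
  head-dominates (r ∷ d) z∈xs =
    ListAll.lookup (Linked.Linked⇒All (λ p q → <c-trans q p) r d) z∈xs

  private
    drop-head : ∀ {x z} {xs ys : List (ColInt k)} → StrictDec (x ∷ xs) →
      z ∈ xs → z ∈ x ∷ ys → z ∈ ys
    drop-head d z∈xs (here refl)  = ⊥-elim (<c-irrefl (head-dominates d z∈xs))
    drop-head d z∈xs (there z∈ys) = z∈ys

    heads-≡ : ∀ {x y} {xs ys : List (ColInt k)} → StrictDec (x ∷ xs) → StrictDec (y ∷ ys) →
      x ∈ y ∷ ys → y ∈ x ∷ xs → x ≡ y
    heads-≡ _  _  (here x≡y)   _            = x≡y
    heads-≡ _  _  (there _)    (here y≡x)   = sym y≡x
    heads-≡ dx dy (there x∈ys) (there y∈xs) =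
      ⊥-elim (<c-irrefl (<c-trans (head-dominates dy x∈ys) (head-dominates dx y∈xs)))

  strictDec-≡ : {xs ys : List (ColInt k)} → StrictDec xs → StrictDec ys →
    (∀ {z} → z ∈ xs ⇔ z ∈ ys) → xs ≡ ys
  strictDec-≡ {[]}     {[]}     _ _ _ = refl
  strictDec-≡ {[]}     {y ∷ ys} _ _ xs⇔ys with from xs⇔ys (here refl)
  ... | ()
  strictDec-≡ {x ∷ xs} {[]}     _ _ xs⇔ys with to xs⇔ys (here refl)
  ... | ()
  strictDec-≡ {x ∷ xs} {y ∷ ys} dx dy xs⇔ys
    with refl ← heads-≡ dx dy (to xs⇔ys (here refl)) (from xs⇔ys (here refl))
    = cong (x ∷_) (strictDec-≡ (Linked.tail dx) (Linked.tail dy) tails)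
    where
    tails : ∀ {z} → z ∈ xs ⇔ z ∈ ys
    tails = mk⇔ (λ z∈xs → drop-head dx z∈xs (to xs⇔ys (there z∈xs)))
                (λ z∈ys → drop-head dy z∈ys (from xs⇔ys (there z∈ys)))

colorsDesc : ∀ {j} → Subset j → List (Fin j)
colorsDesc []          = []
colorsDesc (true ∷ r)  = map suc (colorsDesc r) ++ zero ∷ []
colorsDesc (false ∷ r) = map suc (colorsDesc r)

colorsDesc-decreasing : ∀ {j} (r : Subset j) → Linked Fin._>_ (colorsDesc r)
colorsDesc-decreasing []                 = []
colorsDesc-decreasing {suc j} (true ∷ r) =
  linked-++ suc-decreasing [-] λ { x∈ (here refl) → zero<suc x∈ }
  where
  suc-decreasing : Linked Fin._>_ (map suc (colorsDesc r))
  suc-decreasing = Linked.map⁺ (Linked.map s≤s (colorsDesc-decreasing r))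
  zero<suc : ∀ {x} → x ∈ map suc (colorsDesc r) → Fin.zero {j} Fin.< x
  zero<suc x∈ with ∈-map⁻ suc x∈
  ... | _ , _ , refl = s≤s z≤n
colorsDesc-decreasing (false ∷ r)        = Linked.map⁺ (Linked.map s≤s (colorsDesc-decreasing r))

∈-colorsDesc : ∀ {j} (r : Subset j) {c} → c ∈ colorsDesc r ⇔ lookup r c ≡ true
∈-colorsDesc r = mk⇔ (⇒ r) (⇐ r)
  where
  ⇒ : ∀ {j} (r : Subset j) {c} → c ∈ colorsDesc r → lookup r c ≡ true
  ⇒ (true ∷ r) {zero} c∈ with ∈-++⁻ (map suc (colorsDesc r)) c∈
  ... | inj₁ c∈′ with ∈-map⁻ suc c∈′
  ...   | _ , _ , ()
  ⇒ (true ∷ r) {zero} c∈ | inj₂ _ = refl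
  ⇒ (true ∷ r) {suc c} c∈ with ∈-++⁻ (map suc (colorsDesc r)) c∈
  ... | inj₁ c∈′ with ∈-map⁻ suc c∈′
  ...   | _ , c∈r , refl = ⇒ r c∈r
  ⇒ (true ∷ r) {suc c} c∈ | inj₂ (here ())
  ⇒ (false ∷ r) c∈ with ∈-map⁻ suc c∈
  ... | _ , c∈r , refl = ⇒ r c∈r
  ⇐ : ∀ {j} (r : Subset j) {c} → lookup r c ≡ true → c ∈ colorsDesc r
  ⇐ (true ∷ r)  {zero}  _ = ∈-++⁺ʳ (map suc (colorsDesc r)) (here refl)
  ⇐ (true ∷ r)  {suc c} e = ∈-++⁺ˡ (∈-map⁺ suc (⇐ r e))
  ⇐ (false ∷ r) {suc c} e = ∈-map⁺ suc (⇐ r e)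

length-colorsDesc : ∀ {j} (r : Subset j) → length (colorsDesc r) ≡ ∣ r ∣
length-colorsDesc []          = refl
length-colorsDesc (true ∷ r)  = begin
  length (map suc (colorsDesc r) ++ zero ∷ [])  ≡⟨ List.length-++ (map suc (colorsDesc r)) ⟩
  length (map suc (colorsDesc r)) + 1           ≡⟨ ℕ.+-comm _ 1 ⟩
  suc (length (map suc (colorsDesc r)))         ≡⟨ cong suc (List.length-map suc (colorsDesc r)) ⟩
  suc (length (colorsDesc r))                   ≡⟨ cong suc (length-colorsDesc r) ⟩
  suc ∣ r ∣                                     ∎
  where open ≡-Reasoning
length-colorsDesc (false ∷ r) =
  trans (List.length-map suc (colorsDesc r)) (length-colorsDesc r)

module _ {k : ℕ} where
  open import Data.List.Membership.DecPropositional (Product.≡-dec ℕ._≟_ (Fin._≟_ {k}))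
    using (_∈?_)

  row : ℕ → Subset k → List (ColInt k)
  row v r = map (v ,_) (colorsDesc r)

  rows : ∀ {B} → Vec (Subset k) B → List (ColInt k)
  rows []              = []
  rows {suc B} (r ∷ R) = row B r ++ rows R

  rowOf : ℕ → List (ColInt k) → Subset k
  rowOf v L = tabulate (λ c → does ((v , c) ∈? L))

  table : (B : ℕ) → List (ColInt k) → Vec (Subset k) B
  table zero    L = []
  table (suc B) L = rowOf B L ∷ table B L

  ∈-row : ∀ r {u v c} → (u , c) ∈ row v r ⇔ (u ≡ v × lookup r c ≡ true)
  ∈-row r = mk⇔ ⇒ ⇐
    where
    ⇒ : ∀ {u v c} → (u , c) ∈ row v r → u ≡ v × lookup r c ≡ true
    ⇒ z∈ with ∈-map⁻ _ z∈
    ... | _ , c∈ , refl = refl , to (∈-colorsDesc r) c∈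
    ⇐ : ∀ {u v c} → u ≡ v × lookup r c ≡ true → (u , c) ∈ row v r
    ⇐ (refl , c∈r) = ∈-map⁺ _ (from (∈-colorsDesc r) c∈r)

  row-strictDec : ∀ v r → StrictDec (row v r)
  row-strictDec v r =
    Linked.map⁺ (Linked.map (λ c>c′ → inj₂ (refl , c>c′)) (colorsDesc-decreasing r))

  rows-bounded : ∀ {B} (R : Vec (Subset k) B) {z} → z ∈ rows R → proj₁ z < B
  rows-bounded {suc B} (r ∷ R) z∈ with ∈-++⁻ (row B r) z∈
  ... | inj₁ z∈r = ℕ.≤-reflexive (cong suc (proj₁ (to (∈-row r) z∈r)))
  ... | inj₂ z∈R = ℕ.m<n⇒m<1+n (rows-bounded R z∈R)

  rows-strictDec : ∀ {B} (R : Vec (Subset k) B) → StrictDec (rows R)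
  rows-strictDec []              = []
  rows-strictDec {suc B} (r ∷ R) =
    linked-++ (row-strictDec B r) (rows-strictDec R) later-rows-smaller
    where
    later-rows-smaller : ∀ {x y} → x ∈ row B r → y ∈ rows R → y <c x
    later-rows-smaller {_ , _} x∈r y∈R with refl ← proj₁ (to (∈-row r) x∈r) =
      inj₁ (rows-bounded R y∈R)

  ∈-rowOf : ∀ {v L c} → lookup (rowOf v L) c ≡ true ⇔ (v , c) ∈ L
  ∈-rowOf {v} {L} {c} rewrite Vec.lookup∘tabulate (λ c → does ((v , c) ∈? L)) c =
    does⇔ ((v , c) ∈? L)

  rowOf-≡ : ∀ {v L r} → (∀ {c} → (v , c) ∈ L ⇔ lookup r c ≡ true) → rowOf v L ≡ r
  rowOf-≡ {v} {L} {r} L⇔r =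
    trans (Vec.tabulate-cong (λ c → ⇔→≡ (⇔-trans (does⇔ ((v , c) ∈? L)) L⇔r)))
          (Vec.tabulate∘lookup r)

  table-cong : ∀ B {L L′} → (∀ {v c} → v < B → (v , c) ∈ L ⇔ (v , c) ∈ L′) →
    table B L ≡ table B L′
  table-cong zero    L⇔L′ = refl
  table-cong (suc B) L⇔L′ = cong₂ _∷_
    (rowOf-≡ (⇔-trans (L⇔L′ ℕ.≤-refl) (⇔-sym ∈-rowOf)))
    (table-cong B (λ v<B → L⇔L′ (ℕ.m<n⇒m<1+n v<B)))

  ∈-rows-table : ∀ B L {z} → z ∈ rows (table B L) ⇔ (proj₁ z < B × z ∈ L)
  ∈-rows-table zero    L = mk⇔ (λ ()) (λ ())
  ∈-rows-table (suc B) L {u , c} = mk⇔ ⇒ ⇐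
    where
    ⇒ : (u , c) ∈ rows (table (suc B) L) → u < suc B × (u , c) ∈ L
    ⇒ z∈ with ∈-++⁻ (row B (rowOf B L)) z∈
    ... | inj₁ z∈row with refl , bit ← to (∈-row (rowOf B L)) z∈row = ℕ.≤-refl , to ∈-rowOf bit
    ... | inj₂ z∈rows = map₁ ℕ.m<n⇒m<1+n (to (∈-rows-table B L) z∈rows)
    ⇐ : u < suc B × (u , c) ∈ L → (u , c) ∈ rows (table (suc B) L)
    ⇐ (u<1+B , z∈L) with u ℕ.≟ B
    ... | yes refl = ∈-++⁺ˡ (from (∈-row (rowOf B L)) (refl , from ∈-rowOf z∈L))
    ... | no u≢B   = ∈-++⁺ʳ (row B (rowOf B L))
                       (from (∈-rows-table B L) (ℕ.≤∧≢⇒< (ℕ.≤-pred u<1+B) u≢B , z∈L))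

  rows-table : ∀ B {L} → StrictDec L → (∀ {z} → z ∈ L → proj₁ z < B) → rows (table B L) ≡ L
  rows-table B {L} dL L<B = strictDec-≡ (rows-strictDec (table B L)) dL
    (mk⇔ (λ z∈ → proj₂ (to (∈-rows-table B L) z∈))
         (λ z∈L → from (∈-rows-table B L) (L<B z∈L , z∈L)))

  table-rows : ∀ {B} (R : Vec (Subset k) B) → table B (rows R) ≡ R
  table-rows []              = refl
  table-rows {suc B} (r ∷ R) = cong₂ _∷_
    (rowOf-≡ (mk⇔ top-row (λ c∈r → ∈-++⁺ˡ (from (∈-row r) (refl , c∈r)))))
    (trans (table-cong B (λ v<B → mk⇔ (lower-rows v<B) (∈-++⁺ʳ (row B r))))
           (table-rows R))
    where
    top-row : ∀ {c} → (B , c) ∈ row B r ++ rows R → lookup r c ≡ true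
    top-row z∈ with ∈-++⁻ (row B r) z∈
    ... | inj₁ z∈r = proj₂ (to (∈-row r) z∈r)
    ... | inj₂ z∈R = ⊥-elim (ℕ.<-irrefl refl (rows-bounded R z∈R))
    lower-rows : ∀ {v c} → v < B → (v , c) ∈ row B r ++ rows R → (v , c) ∈ rows R
    lower-rows v<B z∈ with ∈-++⁻ (row B r) z∈
    ... | inj₁ z∈r = ⊥-elim (ℕ.<-irrefl (proj₁ (to (∈-row r) z∈r)) v<B)
    ... | inj₂ z∈R = z∈R

module _ {k : ℕ} where

  size : ∀ {B} → Vec (Subset k) B → ℕ
  size []      = 0
  size (r ∷ R) = ∣ r ∣ + size R

  labelSum : ∀ {B} → Vec (Subset k) B → ℕ
  labelSum []              = 0
  labelSum {suc B} (r ∷ R) = B * ∣ r ∣ + labelSum R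

  labelSumFrom : ∀ {B} → ℕ → Vec (Subset k) B → ℕ
  labelSumFrom i []      = 0
  labelSumFrom i (r ∷ R) = i * ∣ r ∣ + labelSumFrom (suc i) R

  -- A step of a path of length L raises all later heights, and area4 counts each of
  -- those heights twice except the last; hence the weight 2 * (steps left) + 1.
  areaSum : ∀ {L} → Vec (Subset k) L → ℕ
  areaSum []              = 0
  areaSum {suc L} (T ∷ w) = ∣ T ∣ * (2 * L + 1) + areaSum w

  length-rows : ∀ {B} (R : Vec (Subset k) B) → length (rows R) ≡ size R
  length-rows []              = refl
  length-rows {suc B} (r ∷ R) = begin
    length (row B r ++ rows R)          ≡⟨ List.length-++ (row B r) ⟩
    length (row B r) + length (rows R)  ≡⟨ cong₂ _+_ length-row (length-rows R) ⟩
    ∣ r ∣ + size R                      ∎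
    where
    open ≡-Reasoning
    length-row : length (row B r) ≡ ∣ r ∣
    length-row = trans (List.length-map (B ,_) (colorsDesc r)) (length-colorsDesc r)

  sum-rows : ∀ {B} (R : Vec (Subset k) B) → sum (map proj₁ (rows R)) ≡ labelSum R
  sum-rows []              = refl
  sum-rows {suc B} (r ∷ R) = begin
    sum (map proj₁ (row B r ++ rows R))                        ≡⟨ cong sum (List.map-++ proj₁ (row B r) (rows R)) ⟩
    sum (map proj₁ (row B r) ++ map proj₁ (rows R))            ≡⟨ Sum.sum-++ (map proj₁ (row B r)) _ ⟩
    sum (map proj₁ (row B r)) + sum (map proj₁ (rows R))       ≡⟨ cong₂ _+_ (sum-row (colorsDesc r)) (sum-rows R) ⟩
    B * length (colorsDesc r) + labelSum R                     ≡⟨ cong (λ l → B * l + labelSum R) (length-colorsDesc r) ⟩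
    B * ∣ r ∣ + labelSum R                                     ∎
    where
    open ≡-Reasoning
    sum-row : ∀ cs → sum (map proj₁ (map (B ,_) cs)) ≡ B * length cs
    sum-row []       = sym (ℕ.*-zeroʳ B)
    sum-row (c ∷ cs) = trans (cong (_+_ B) (sum-row cs)) (sym (ℕ.*-suc B (length cs)))

  size-∷ʳ : ∀ {B} (R : Vec (Subset k) B) r → size (R ∷ʳ r) ≡ size R + ∣ r ∣
  size-∷ʳ []       r = ℕ.+-comm ∣ r ∣ 0
  size-∷ʳ (x ∷ R) r = trans (cong (_+_ (∣ x ∣)) (size-∷ʳ R r)) (sym (ℕ.+-assoc ∣ x ∣ _ _))

  labelSumFrom-∷ʳ : ∀ {B} i (R : Vec (Subset k) B) r →
    labelSumFrom i (R ∷ʳ r) ≡ labelSumFrom i R + (i + B) * ∣ r ∣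
  labelSumFrom-∷ʳ i []      r = trans (ℕ.+-identityʳ _) (cong (_* ∣ r ∣) (sym (ℕ.+-identityʳ i)))
  labelSumFrom-∷ʳ {suc B} i (x ∷ R) r = begin
    i * ∣ x ∣ + labelSumFrom (suc i) (R ∷ʳ r)
      ≡⟨ cong (_+_ (i * ∣ x ∣)) (labelSumFrom-∷ʳ (suc i) R r) ⟩
    i * ∣ x ∣ + (labelSumFrom (suc i) R + (suc i + B) * ∣ r ∣)
      ≡⟨ cong (λ l → i * ∣ x ∣ + (labelSumFrom (suc i) R + l * ∣ r ∣)) (sym (ℕ.+-suc i B)) ⟩
    i * ∣ x ∣ + (labelSumFrom (suc i) R + (i + suc B) * ∣ r ∣)
      ≡⟨ sym (ℕ.+-assoc (i * ∣ x ∣) _ _) ⟩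
    i * ∣ x ∣ + labelSumFrom (suc i) R + (i + suc B) * ∣ r ∣  ∎
    where open ≡-Reasoning

  size-reverse : ∀ {B} (R : Vec (Subset k) B) → size (reverse R) ≡ size R
  size-reverse []      = refl
  size-reverse (r ∷ R) = begin
    size (reverse (r ∷ R))    ≡⟨ cong size (Vec.reverse-∷ r R) ⟩
    size (reverse R ∷ʳ r)     ≡⟨ size-∷ʳ (reverse R) r ⟩
    size (reverse R) + ∣ r ∣  ≡⟨ cong (_+ ∣ r ∣) (size-reverse R) ⟩
    size R + ∣ r ∣            ≡⟨ ℕ.+-comm (size R) ∣ r ∣ ⟩
    ∣ r ∣ + size R            ∎
    where open ≡-Reasoning

  labelSumFrom-reverse : ∀ {B} (R : Vec (Subset k) B) → labelSumFrom 0 (reverse R) ≡ labelSum R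
  labelSumFrom-reverse []              = refl
  labelSumFrom-reverse {suc B} (r ∷ R) = begin
    labelSumFrom 0 (reverse (r ∷ R))          ≡⟨ cong (labelSumFrom 0) (Vec.reverse-∷ r R) ⟩
    labelSumFrom 0 (reverse R ∷ʳ r)           ≡⟨ labelSumFrom-∷ʳ 0 (reverse R) r ⟩
    labelSumFrom 0 (reverse R) + B * ∣ r ∣    ≡⟨ cong (_+ B * ∣ r ∣) (labelSumFrom-reverse R) ⟩
    labelSum R + B * ∣ r ∣                    ≡⟨ ℕ.+-comm (labelSum R) _ ⟩
    B * ∣ r ∣ + labelSum R                    ∎
    where open ≡-Reasoning

  size-join : ∀ {n m} (X : Vec (Subset k) n) (Y : Vec (Subset k) (suc m)) →
    size (join X Y) ≡ size X + size Y
  size-join []      Y = refl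
  size-join (x ∷ X) Y = trans (cong (_+_ (∣ x ∣)) (size-join X Y)) (sym (ℕ.+-assoc ∣ x ∣ _ _))

  areaSum-join : ∀ {n m} (X : Vec (Subset k) n) (Y : Vec (Subset k) (suc m)) →
    areaSum (join X Y) ≡ areaSum X + 2 * suc m * size X + areaSum Y
  areaSum-join {m = m} [] Y = cong (_+ areaSum Y) (sym (ℕ.*-zeroʳ (2 * suc m)))
  areaSum-join {suc n} {m} (x ∷ X) Y =
    trans (cong (_+_ (∣ x ∣ * (2 * suc (n + m) + 1))) (areaSum-join X Y))
          (regroup ∣ x ∣ n m (areaSum X) (size X) (areaSum Y))
    where
    regroup : ∀ a n m w c y → a * (2 * suc (n + m) + 1) + (w + 2 * suc m * c + y)
                            ≡ a * (2 * n + 1) + w + 2 * suc m * (a + c) + y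
    regroup = solve-∀

  size-∁ : ∀ {B} (R : Vec (Subset k) B) → size (Vec.map ∁ R) + size R ≡ k * B
  size-∁ []              = sym (ℕ.*-zeroʳ k)
  size-∁ {suc B} (r ∷ R) = begin
    (∣ ∁ r ∣ + size (Vec.map ∁ R)) + (∣ r ∣ + size R)  ≡⟨ interchange (∣ ∁ r ∣) _ (∣ r ∣) _ ⟩
    (∣ ∁ r ∣ + ∣ r ∣) + (size (Vec.map ∁ R) + size R)  ≡⟨ cong₂ _+_ (∣∁r∣+∣r∣≡k r) (size-∁ R) ⟩
    k + k * B                                          ≡⟨ sym (ℕ.*-suc k B) ⟩
    k * suc B                                          ∎
    where
    open ≡-Reasoning
    interchange : ∀ a b c d → (a + b) + (c + d) ≡ (a + c) + (b + d)
    interchange = solve-∀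

  areaSum-∁ : ∀ {B} (R : Vec (Subset k) B) →
    areaSum (Vec.map ∁ R) + (2 * labelSum R + size R) ≡ k * B * B
  areaSum-∁ []              = sym (ℕ.*-zeroʳ (k * 0))
  areaSum-∁ {suc B} (r ∷ R) = begin
    ∣ ∁ r ∣ * (2 * B + 1) + areaSum (Vec.map ∁ R) + (2 * (B * ∣ r ∣ + labelSum R) + (∣ r ∣ + size R))
      ≡⟨ regroup ∣ ∁ r ∣ ∣ r ∣ B (areaSum (Vec.map ∁ R)) (labelSum R) (size R) ⟩
    (∣ ∁ r ∣ + ∣ r ∣) * (2 * B + 1) + (areaSum (Vec.map ∁ R) + (2 * labelSum R + size R))
      ≡⟨ cong₂ (λ x y → x * (2 * B + 1) + y) (∣∁r∣+∣r∣≡k r) (areaSum-∁ R) ⟩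
    k * (2 * B + 1) + k * B * B
      ≡⟨ square k B ⟩
    k * suc B * suc B  ∎
    where
    open ≡-Reasoning
    regroup : ∀ a b B w v c → a * (2 * B + 1) + w + (2 * (B * b + v) + (b + c))
                            ≡ (a + b) * (2 * B + 1) + (w + (2 * v + c))
    regroup = solve-∀
    square : ∀ k B → k * (2 * B + 1) + k * B * B ≡ k * suc B * suc B
    square = solve-∀

  areaSum-ascending : ∀ {L} i (Y : Vec (Subset k) L) →
    areaSum Y + 2 * labelSumFrom i Y + size Y ≡ 2 * (i + L) * size Y
  areaSum-ascending i []              = sym (ℕ.*-zeroʳ (2 * (i + 0)))
  areaSum-ascending {suc L} i (T ∷ Y) = begin
    ∣ T ∣ * (2 * L + 1) + areaSum Y + 2 * (i * ∣ T ∣ + labelSumFrom (suc i) Y) + (∣ T ∣ + size Y)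
      ≡⟨ regroup ∣ T ∣ i L (areaSum Y) (labelSumFrom (suc i) Y) (size Y) ⟩
    ∣ T ∣ * (2 * (i + suc L)) + (areaSum Y + 2 * labelSumFrom (suc i) Y + size Y)
      ≡⟨ cong (_+_ (∣ T ∣ * (2 * (i + suc L)))) (areaSum-ascending (suc i) Y) ⟩
    ∣ T ∣ * (2 * (i + suc L)) + 2 * (suc i + L) * size Y
      ≡⟨ collect ∣ T ∣ i L (size Y) ⟩
    2 * (i + suc L) * (∣ T ∣ + size Y)  ∎
    where
    open ≡-Reasoning
    regroup : ∀ x i L w v c → x * (2 * L + 1) + w + 2 * (i * x + v) + (x + c)
                            ≡ x * (2 * (i + suc L)) + (w + 2 * v + c)
    regroup = solve-∀
    collect : ∀ x i L c → x * (2 * (i + suc L)) + 2 * (suc i + L) * c ≡ 2 * (i + suc L) * (x + c)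
    collect = solve-∀

labelSumFrom-lower : ∀ {k L} i (Y : Vec (Subset k) L) → i * size Y ≤ labelSumFrom i Y
labelSumFrom-lower i []      = ℕ.≤-reflexive (ℕ.*-zeroʳ i)
labelSumFrom-lower i (r ∷ Y) = begin
  i * (∣ r ∣ + size Y)                 ≡⟨ ℕ.*-distribˡ-+ i ∣ r ∣ (size Y) ⟩
  i * ∣ r ∣ + i * size Y               ≤⟨ ℕ.+-monoʳ-≤ (i * ∣ r ∣) (ℕ.*-monoˡ-≤ (size Y) (ℕ.n≤1+n i)) ⟩
  i * ∣ r ∣ + suc i * size Y           ≤⟨ ℕ.+-monoʳ-≤ (i * ∣ r ∣) (labelSumFrom-lower (suc i) Y) ⟩
  i * ∣ r ∣ + labelSumFrom (suc i) Y   ∎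
  where open ℕ.≤-Reasoning

∈⇒proj₁≤sum : ∀ {k} {z : ColInt k} {L} → z ∈ L → proj₁ z ≤ sum (map proj₁ L)
∈⇒proj₁≤sum (here refl)           = ℕ.m≤m+n _ _
∈⇒proj₁≤sum {L = x ∷ L} (there z∈) = ℕ.≤-trans (∈⇒proj₁≤sum z∈) (ℕ.m≤n+m _ (proj₁ x))

∈⇒proj₁<length+sum : ∀ {k} {z : ColInt k} {L} → z ∈ L → proj₁ z < length L + sum (map proj₁ L)
∈⇒proj₁<length+sum {L = _ ∷ L} z∈ = ℕ.+-mono-≤ (s≤s (z≤n {length L})) (∈⇒proj₁≤sum z∈)

module _ {k : ℕ} (A : ℕ) where

  end2-closed : ∀ {L} h (w : Vec (Subset k) L) →
    end2 A h w ≡ h ℤ.+ (+ (2 * size w + L * A) ℤ.- + (L * k))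
  end2-closed h []      = sym (ℤ.+-identityʳ h)
  end2-closed {suc L} h (T ∷ w) = begin
    end2 A (h ℤ.+ (+ a ℤ.- + k)) w
      ≡⟨ end2-closed (h ℤ.+ (+ a ℤ.- + k)) w ⟩
    h ℤ.+ (+ a ℤ.- + k) ℤ.+ (+ c ℤ.- + d)
      ≡⟨ regroup h (+ a) (+ k) (+ c) (+ d) ⟩
    h ℤ.+ ((+ a ℤ.+ + c) ℤ.- (+ k ℤ.+ + d))
      ≡⟨ cong₂ (λ x y → h ℤ.+ (x ℤ.- y)) (sym (ℤ.pos-+ a c)) (sym (ℤ.pos-+ k d)) ⟩
    h ℤ.+ (+ (a + c) ℤ.- + (k + d))
      ≡⟨ cong (λ x → h ℤ.+ (+ x ℤ.- + (k + d))) (split-step ∣ T ∣ (size w) L A) ⟩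
    h ℤ.+ (+ (2 * (∣ T ∣ + size w) + suc L * A) ℤ.- + (suc L * k))  ∎
    where
    open ≡-Reasoning
    a c d : ℕ
    a = 2 * ∣ T ∣ + A
    c = 2 * size w + L * A
    d = L * k
    regroup : ∀ h a k c d → h ℤ.+ (a ℤ.- k) ℤ.+ (c ℤ.- d) ≡ h ℤ.+ ((a ℤ.+ c) ℤ.- (k ℤ.+ d))
    regroup = ℤ-Solver.solve-∀
    split-step : ∀ t s L A → (2 * t + A) + (2 * s + L * A) ≡ 2 * (t + s) + (A + L * A)
    split-step = solve-∀

  area4-closed : ∀ {L} h (w : Vec (Subset k) L) →
    area4 A h w ≡ + (2 * L) ℤ.* h ℤ.+ (+ (2 * areaSum w + L * L * A) ℤ.- + (L * L * k))
  area4-closed h []      = sym (ℤ.+-identityʳ (+ 0 ℤ.* h))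
  area4-closed {suc L} h (T ∷ w) = begin
    h ℤ.+ (h ℤ.+ (+ a ℤ.- + k)) ℤ.+ area4 A (h ℤ.+ (+ a ℤ.- + k)) w
      ≡⟨ cong (ℤ._+_ (h ℤ.+ (h ℤ.+ (+ a ℤ.- + k)))) (area4-closed (h ℤ.+ (+ a ℤ.- + k)) w) ⟩
    h ℤ.+ (h ℤ.+ (+ a ℤ.- + k)) ℤ.+ (+ (2 * L) ℤ.* (h ℤ.+ (+ a ℤ.- + k)) ℤ.+ (+ P ℤ.- + Q))
      ≡⟨ regroup h (+ a) (+ k) (+ (2 * L)) (+ P) (+ Q) ⟩
    (+ (2 * L) ℤ.+ + 2) ℤ.* h
      ℤ.+ (((+ (2 * L) ℤ.+ + 1) ℤ.* + a ℤ.+ + P) ℤ.- ((+ (2 * L) ℤ.+ + 1) ℤ.* + k ℤ.+ + Q))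
      ≡⟨ congₙ 3 (λ x y z → x ℤ.* h ℤ.+ (y ℤ.- z)) (sym (ℤ.pos-+ (2 * L) 2)) (lift a P) (lift k Q) ⟩
    + (2 * L + 2) ℤ.* h ℤ.+ (+ ((2 * L + 1) * a + P) ℤ.- + ((2 * L + 1) * k + Q))
      ≡⟨ congₙ 3 (λ x y z → + x ℤ.* h ℤ.+ (+ y ℤ.- + z))
           (double-suc L) (area-step ∣ T ∣ (areaSum w) L A) (square-step L k) ⟩
    + (2 * suc L) ℤ.* h
      ℤ.+ (+ (2 * (∣ T ∣ * (2 * L + 1) + areaSum w) + suc L * suc L * A) ℤ.- + (suc L * suc L * k))  ∎
    where
    open ≡-Reasoning
    a P Q : ℕ
    a = 2 * ∣ T ∣ + A
    P = 2 * areaSum w + L * L * A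
    Q = L * L * k
    lift : ∀ u v → (+ (2 * L) ℤ.+ + 1) ℤ.* + u ℤ.+ + v ≡ + ((2 * L + 1) * u + v)
    lift u v = begin
      (+ (2 * L) ℤ.+ + 1) ℤ.* + u ℤ.+ + v  ≡⟨ cong (λ x → x ℤ.* + u ℤ.+ + v) (sym (ℤ.pos-+ (2 * L) 1)) ⟩
      + (2 * L + 1) ℤ.* + u ℤ.+ + v        ≡⟨ cong (ℤ._+ + v) (sym (ℤ.pos-* (2 * L + 1) u)) ⟩
      + ((2 * L + 1) * u) ℤ.+ + v          ≡⟨ sym (ℤ.pos-+ ((2 * L + 1) * u) v) ⟩
      + ((2 * L + 1) * u + v)              ∎
    regroup : ∀ h a k x P Q →
      h ℤ.+ (h ℤ.+ (a ℤ.- k)) ℤ.+ (x ℤ.* (h ℤ.+ (a ℤ.- k)) ℤ.+ (P ℤ.- Q))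
        ≡ (x ℤ.+ + 2) ℤ.* h ℤ.+ (((x ℤ.+ + 1) ℤ.* a ℤ.+ P) ℤ.- ((x ℤ.+ + 1) ℤ.* k ℤ.+ Q))
    regroup = ℤ-Solver.solve-∀
    double-suc : ∀ L → 2 * L + 2 ≡ 2 * suc L
    double-suc = solve-∀
    area-step : ∀ t w L A → (2 * L + 1) * (2 * t + A) + (2 * w + L * L * A)
                          ≡ 2 * (t * (2 * L + 1) + w) + suc L * suc L * A
    area-step = solve-∀
    square-step : ∀ L k → (2 * L + 1) * k + L * L * k ≡ suc L * suc L * k
    square-step = solve-∀

-- Rb has length suc (n + 0) rather than suc n because 2 * n unfolds to n + (n + 0).
module GluedPath {k A n : ℕ} (Rt : Vec (Subset k) n) (Rb : Vec (Subset k) (suc (n + 0))) where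

  path : Vec (Subset k) (suc (2 * n))
  path = join (Vec.map ∁ Rt) (reverse Rb)

  private
    N r t s b : ℕ
    N = suc (2 * n)
    r = size Rt
    t = labelSum Rt
    s = size Rb
    b = labelSum Rb
    X : Vec (Subset k) n
    X = Vec.map ∁ Rt

  top-area : ℕ
  top-area = 2 * k * n * (n + 1) + 2 * A * n * (2 * n + 1)

  size-path : size path ≡ size X + s
  size-path = trans (size-join X (reverse Rb)) (cong (_+_ (size X)) (size-reverse Rb))

  end-identity : (2 * size path + N * A) + (2 * r + k) ≡ (2 * n * A + N * k) + (A + 2 * s)
  end-identity = begin
    (2 * size path + N * A) + (2 * r + k)          ≡⟨ cong (λ z → 2 * z + N * A + (2 * r + k)) size-path ⟩
    (2 * (size X + s) + N * A) + (2 * r + k)       ≡⟨ regroup (size X) s r n A k ⟩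
    2 * (size X + r) + (2 * n * A + k) + (A + 2 * s) ≡⟨ cong (λ z → 2 * z + (2 * n * A + k) + (A + 2 * s)) (size-∁ Rt) ⟩
    2 * (k * n) + (2 * n * A + k) + (A + 2 * s)    ≡⟨ collect k n A s ⟩
    (2 * n * A + N * k) + (A + 2 * s)              ∎
    where
    open ≡-Reasoning
    regroup : ∀ x s r n A k → (2 * (x + s) + suc (2 * n) * A) + (2 * r + k)
                            ≡ 2 * (x + r) + (2 * n * A + k) + (A + 2 * s)
    regroup = solve-∀
    collect : ∀ k n A s → 2 * (k * n) + (2 * n * A + k) + (A + 2 * s)
                        ≡ (2 * n * A + suc (2 * n) * k) + (A + 2 * s)
    collect = solve-∀

  ends-at-height : end2 A (+ 0) path ≡ + (A * (2 * n)) ⇔ 2 * r + k ≡ A + 2 * s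
  ends-at-height = mk⇔
    (λ e → to (m+q≡n+p⇒[m≡n⇔q≡p] end-identity) (to +m-+n≡+o⇔m≡o+n (trans (sym closed) (trans e target))))
    (λ e → trans closed (trans (from +m-+n≡+o⇔m≡o+n (from (m+q≡n+p⇒[m≡n⇔q≡p] end-identity) e)) (sym target)))
    where
    closed : end2 A (+ 0) path ≡ + (2 * size path + N * A) ℤ.- + (N * k)
    closed = trans (end2-closed A (+ 0) path) (ℤ.+-identityˡ _)
    target : + (A * (2 * n)) ≡ + (2 * n * A)
    target = cong +_ (ℕ.*-comm A (2 * n))

  area-identity : 2 * r + k ≡ A + 2 * s →
    (2 * areaSum path + N * N * A) + 4 * (r + t + b) ≡ top-area + N * N * k
  -- The two sides differ by a combination of the five hypotheses with the weights of
  -- weigh; adding them on both sides leaves a polynomial identity.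
  area-identity balanced = cancel-combination
    (combination (areaSum path) (areaSum X) (size X) (areaSum (reverse Rb)) r t s b k A n)
    (congₙ 5 weigh (sym (areaSum-join X (reverse Rb))) (sym (areaSum-∁ Rt)) (sym (size-∁ Rt))
                 (sym bottom-area) balanced)
    where
    weigh : ℕ → ℕ → ℕ → ℕ → ℕ → ℕ
    weigh a₀ a₁ a₂ a₃ a₄ = 2 * a₀ + 2 * a₁ + 4 * suc n * a₂ + 2 * a₃ + N * a₄
    bottom-area : areaSum (reverse Rb) + 2 * b + s ≡ 2 * suc (n + 0) * s
    bottom-area = begin
      areaSum (reverse Rb) + 2 * b + s
        ≡⟨ cong₂ (λ x y → areaSum (reverse Rb) + 2 * x + y) (labelSumFrom-reverse Rb) (size-reverse Rb) ⟨
      areaSum (reverse Rb) + 2 * labelSumFrom 0 (reverse Rb) + size (reverse Rb)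
        ≡⟨ areaSum-ascending 0 (reverse Rb) ⟩
      2 * suc (n + 0) * size (reverse Rb)
        ≡⟨ cong (2 * suc (n + 0) *_) (size-reverse Rb) ⟩
      2 * suc (n + 0) * s  ∎
      where open ≡-Reasoning
    combination : ∀ aP aX sX aY r t s b k A n →
      (2 * aP + suc (2 * n) * suc (2 * n) * A + 4 * (r + t + b))
        + (2 * (aX + 2 * suc (n + 0) * sX + aY) + 2 * (k * n * n) + 4 * suc n * (k * n)
           + 2 * (2 * suc (n + 0) * s) + suc (2 * n) * (2 * r + k))
      ≡ (2 * k * n * (n + 1) + 2 * A * n * (2 * n + 1) + suc (2 * n) * suc (2 * n) * k)
        + (2 * aP + 2 * (aX + (2 * t + r)) + 4 * suc n * (sX + r)
           + 2 * (aY + 2 * b + s) + suc (2 * n) * (A + 2 * s))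
    combination = solve-∀

  deficit-is-weight : 2 * r + k ≡ A + 2 * s → ∀ m →
    + top-area ℤ.- area4 A (+ 0) path ≡ + (4 * m) ⇔ r + t + b ≡ m
  deficit-is-weight balanced m = mk⇔
    (λ e → sym (ℕ.*-cancelˡ-≡ m (r + t + b) 4
                  (to (m+q≡n+p⇒[m≡n⇔q≡p] shifted) (to +m-+n≡+o⇔m≡o+n (trans (sym closed) e)))))
    (λ e → trans closed (from +m-+n≡+o⇔m≡o+n (from (m+q≡n+p⇒[m≡n⇔q≡p] shifted) (cong (4 *_) (sym e)))))
    where
    P Q : ℕ
    P = 2 * areaSum path + N * N * A
    Q = N * N * k
    closed : + top-area ℤ.- area4 A (+ 0) path ≡ + (top-area + Q) ℤ.- + P
    closed = begin
      + top-area ℤ.- area4 A (+ 0) path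
        ≡⟨ cong (ℤ._-_ (+ top-area)) (area4-closed A (+ 0) path) ⟩
      + top-area ℤ.- (+ (2 * N) ℤ.* + 0 ℤ.+ (+ P ℤ.- + Q))
        ≡⟨ regroup (+ top-area) (+ (2 * N)) (+ P) (+ Q) ⟩
      (+ top-area ℤ.+ + Q) ℤ.- + P
        ≡⟨ cong (ℤ._- + P) (ℤ.pos-+ top-area Q) ⟨
      + (top-area + Q) ℤ.- + P  ∎
      where
      open ≡-Reasoning
      regroup : ∀ t x p q → t ℤ.- (x ℤ.* + 0 ℤ.+ (p ℤ.- q)) ≡ (t ℤ.+ q) ℤ.- p
      regroup = ℤ-Solver.solve-∀
    shifted : (top-area + Q) + 4 * m ≡ (4 * m + P) + 4 * (r + t + b)
    shifted = trans (cong (_+ 4 * m) (sym (area-identity balanced)))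
                    (regroup P (4 * (r + t + b)) (4 * m))
      where
      regroup : ∀ p u m → (p + u) + m ≡ (m + p) + u
      regroup = solve-∀

Nonneg : ℤ → Set
Nonneg H = + 0 ℤ.≤ H

module _ {k : ℕ} (A : ℕ) where

  end2-join : ∀ {n m} h (X : Vec (Subset k) n) (Y : Vec (Subset k) (suc m)) →
    end2 A h (join X Y) ≡ end2 A (end2 A h X) Y
  end2-join h []      Y = refl
  end2-join h (x ∷ X) Y = end2-join _ X Y

  heights-join : ∀ {n m} {P : ℤ → Set} h (X : Vec (Subset k) n) (Y : Vec (Subset k) (suc m)) →
    All P (heights2 A h X) → All P (heights2 A (end2 A h X) Y) → All P (heights2 A h (join X Y))
  heights-join h []      Y []        PY = PY
  heights-join h (x ∷ X) Y (p ∷ PX) PY = p ∷ heights-join _ X Y PX PY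

  step-∁ : ∀ {a} (r : Subset k) → 2 * ∣ r ∣ ≤ a →
    + a ℤ.+ step2 k A (∁ r) ≡ + (a ∸ 2 * ∣ r ∣ + (k + A))
  step-∁ {a} r room = begin
    + a ℤ.+ (+ (2 * ∣ ∁ r ∣ + A) ℤ.- + k)   ≡⟨ regroup (+ a) (+ (2 * ∣ ∁ r ∣ + A)) (+ k) ⟩
    (+ a ℤ.+ + (2 * ∣ ∁ r ∣ + A)) ℤ.- + k   ≡⟨ cong (ℤ._- + k) (ℤ.pos-+ a _) ⟨
    + (a + (2 * ∣ ∁ r ∣ + A)) ℤ.- + k       ≡⟨ from +m-+n≡+o⇔m≡o+n balance ⟩
    + (a ∸ 2 * ∣ r ∣ + (k + A))             ∎
    where
    open ≡-Reasoning
    regroup : ∀ a b c → a ℤ.+ (b ℤ.- c) ≡ (a ℤ.+ b) ℤ.- c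
    regroup = ℤ-Solver.solve-∀
    balance : a + (2 * ∣ ∁ r ∣ + A) ≡ a ∸ 2 * ∣ r ∣ + (k + A) + k
    balance = begin
      a + (2 * ∣ ∁ r ∣ + A)
        ≡⟨ cong (_+ (2 * ∣ ∁ r ∣ + A)) (ℕ.m+[n∸m]≡n room) ⟨
      2 * ∣ r ∣ + (a ∸ 2 * ∣ r ∣) + (2 * ∣ ∁ r ∣ + A)
        ≡⟨ gather (∣ r ∣) (a ∸ 2 * ∣ r ∣) (∣ ∁ r ∣) A ⟩
      (a ∸ 2 * ∣ r ∣) + 2 * (∣ ∁ r ∣ + ∣ r ∣) + A
        ≡⟨ cong (λ z → (a ∸ 2 * ∣ r ∣) + 2 * z + A) (∣∁r∣+∣r∣≡k r) ⟩
      (a ∸ 2 * ∣ r ∣) + 2 * k + A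
        ≡⟨ spread (a ∸ 2 * ∣ r ∣) k A ⟩
      a ∸ 2 * ∣ r ∣ + (k + A) + k  ∎
      where
      gather : ∀ x e c A → 2 * x + e + (2 * c + A) ≡ e + 2 * (c + x) + A
      gather = solve-∀
      spread : ∀ e k A → e + 2 * k + A ≡ e + (k + A) + k
      spread = solve-∀

  nonneg-before : ∀ {L} h (Y : Vec (Subset k) L) {E} → end2 A h Y ≡ + E →
    2 * size Y + L * A ≤ E + L * k → Nonneg h
  nonneg-before {L} h Y {E} ends room = subst Nonneg (sym h≡) (ℤ.i≤j⇒0≤j-i (+≤+ room))
    where
    open ≡-Reasoning
    regroup : ∀ h x y → h ≡ (h ℤ.+ (x ℤ.- y)) ℤ.+ y ℤ.- x
    regroup = ℤ-Solver.solve-∀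
    h≡ : h ≡ + (E + L * k) ℤ.- + (2 * size Y + L * A)
    h≡ = begin
      h
        ≡⟨ regroup h (+ (2 * size Y + L * A)) (+ (L * k)) ⟩
      (h ℤ.+ (+ (2 * size Y + L * A) ℤ.- + (L * k))) ℤ.+ + (L * k) ℤ.- + (2 * size Y + L * A)
        ≡⟨ cong (λ z → z ℤ.+ + (L * k) ℤ.- + (2 * size Y + L * A)) (trans (sym (end2-closed A h Y)) ends) ⟩
      + E ℤ.+ + (L * k) ℤ.- + (2 * size Y + L * A)
        ≡⟨ cong (ℤ._- + (2 * size Y + L * A)) (ℤ.pos-+ E (L * k)) ⟨
      + (E + L * k) ℤ.- + (2 * size Y + L * A)  ∎

module _ {k A : ℕ} (2≤k+A : 2 ≤ k + A) (m : ℕ) where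

  -- B ∸ m counts the steps still to come whose row has label at least m; such
  -- rows are empty, so each of these steps climbs by k + A ≥ 2.
  top-nonneg : ∀ {B} (R : Vec (Subset k) B) a → size R + labelSum R ≤ m →
    2 * size R ≤ a + 2 * (B ∸ m) → All Nonneg (heights2 A (+ a) (Vec.map ∁ R))
  top-nonneg []              a _    _     = []
  top-nonneg {suc B} (r ∷ R) a cost slack =
    subst (λ h → All Nonneg (h ∷ heights2 A h (Vec.map ∁ R))) (sym (step-∁ A r room))
      (+≤+ z≤n ∷ top-nonneg R (a ∸ 2 * ∣ r ∣ + (k + A)) cost′ slack′)
    where
    open ℕ.≤-Reasoning
    cost′ : size R + labelSum R ≤ m
    cost′ = ℕ.≤-trans (ℕ.+-mono-≤ (ℕ.m≤n+m (size R) ∣ r ∣) (ℕ.m≤n+m (labelSum R) (B * ∣ r ∣))) cost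
    empty-row : m < suc B → ∣ r ∣ ≡ 0
    empty-row = m*n≤o<m⇒n≡0 (suc B) ∣ r ∣
      (ℕ.≤-trans (ℕ.+-mono-≤ (ℕ.m≤m+n ∣ r ∣ (size R)) (ℕ.m≤m+n (B * ∣ r ∣) (labelSum R))) cost)
    room&slack : 2 * ∣ r ∣ ≤ a × 2 * size R ≤ a ∸ 2 * ∣ r ∣ + (k + A) + 2 * (B ∸ m)
    room&slack with suc B ℕ.≤? m
    ... | yes 1+B≤m = ℕ.m+n≤o⇒m≤o (2 * ∣ r ∣) tight , (begin
      2 * size R                               ≤⟨ ℕ.m+n≤o⇒m≤o∸n (2 * size R) (subst (_≤ a) (ℕ.+-comm (2 * ∣ r ∣) _) tight) ⟩
      a ∸ 2 * ∣ r ∣                            ≤⟨ ℕ.m≤m+n _ _ ⟩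
      a ∸ 2 * ∣ r ∣ + (k + A)                  ≤⟨ ℕ.m≤m+n _ _ ⟩
      a ∸ 2 * ∣ r ∣ + (k + A) + 2 * (B ∸ m)    ∎)
      where
      tight : 2 * ∣ r ∣ + 2 * size R ≤ a
      tight = begin
        2 * ∣ r ∣ + 2 * size R     ≡⟨ ℕ.*-distribˡ-+ 2 ∣ r ∣ (size R) ⟨
        2 * (∣ r ∣ + size R)       ≤⟨ slack ⟩
        a + 2 * (suc B ∸ m)        ≡⟨ cong (λ d → a + 2 * d) (ℕ.m≤n⇒m∸n≡0 1+B≤m) ⟩
        a + 0                      ≡⟨ ℕ.+-identityʳ a ⟩
        a                          ∎
    ... | no 1+B≰m rewrite empty-row (ℕ.≰⇒> 1+B≰m) = z≤n , (begin
      2 * size R                        ≤⟨ slack ⟩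
      a + 2 * (suc B ∸ m)               ≡⟨ cong (λ d → a + 2 * d) (ℕ.+-∸-assoc 1 m≤B) ⟩
      a + 2 * suc (B ∸ m)               ≡⟨ regroup a (B ∸ m) ⟩
      a + 2 + 2 * (B ∸ m)               ≤⟨ ℕ.+-monoˡ-≤ (2 * (B ∸ m)) (ℕ.+-monoʳ-≤ a 2≤k+A) ⟩
      a + (k + A) + 2 * (B ∸ m)         ∎)
      where
      m≤B : m ≤ B
      m≤B = ℕ.≤-pred (ℕ.≰⇒> 1+B≰m)
      regroup : ∀ a d → a + 2 * suc d ≡ a + 2 + 2 * d
      regroup = solve-∀
    room : 2 * ∣ r ∣ ≤ a
    room = proj₁ room&slack
    slack′ : 2 * size R ≤ a ∸ 2 * ∣ r ∣ + (k + A) + 2 * (B ∸ m)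
    slack′ = proj₂ room&slack

late-rows-sparse : ∀ {m n i c L} → 3 * m ≤ n → suc i * c ≤ m → suc i + L ≡ suc n → 2 * c ≤ L
late-rows-sparse {c = zero} _ _ _ = z≤n
late-rows-sparse {m} {n} {i} {suc c} {L} 3m≤n cost len = begin
  2 * suc c  ≤⟨ ℕ.*-monoʳ-≤ 2 (ℕ.≤-trans (ℕ.m≤n*m (suc c) (suc i)) cost) ⟩
  2 * m      ≤⟨ ℕ.+-cancelˡ-≤ i (2 * m) L i+2m≤i+L ⟩
  L          ∎
  where
  open ℕ.≤-Reasoning
  three : ∀ m → m + 2 * m ≡ 3 * m
  three = solve-∀
  i+2m≤i+L : i + 2 * m ≤ i + L
  i+2m≤i+L = begin
    i + 2 * m  ≤⟨ ℕ.+-monoˡ-≤ (2 * m) (ℕ.<⇒≤ (ℕ.≤-trans (ℕ.m≤m*n (suc i) (suc c)) cost)) ⟩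
    m + 2 * m  ≡⟨ three m ⟩
    3 * m      ≤⟨ 3m≤n ⟩
    n          ≡⟨ ℕ.suc-injective len ⟨
    i + L      ∎

module _ {k A : ℕ} (0<k : 0 < k) {m n : ℕ} (3m≤n : 3 * m ≤ n) where

  bottom-nonneg : ∀ {L} i (Y : Vec (Subset k) L) h → i + L ≡ suc n → labelSumFrom i Y ≤ m →
    end2 A h Y ≡ + (A * (2 * n)) → All Nonneg (heights2 A h Y)
  bottom-nonneg i []              h _   _    _    = []
  bottom-nonneg {suc L} i (T ∷ Y) h len cost ends =
    nonneg-before A h′ Y ends room ∷ bottom-nonneg (suc i) Y h′ len′ cost′ ends
    where
    open ℕ.≤-Reasoning
    h′ : ℤ
    h′ = h ℤ.+ step2 k A T
    len′ : suc i + L ≡ suc n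
    len′ = trans (sym (ℕ.+-suc i L)) len
    cost′ : labelSumFrom (suc i) Y ≤ m
    cost′ = ℕ.≤-trans (ℕ.m≤n+m _ (i * ∣ T ∣)) cost
    L≤n : L ≤ n
    L≤n = ℕ.≤-pred (ℕ.≤-trans (ℕ.m≤n+m (suc L) i) (ℕ.≤-reflexive len))
    room : 2 * size Y + L * A ≤ A * (2 * n) + L * k
    room = begin
      2 * size Y + L * A   ≤⟨ ℕ.+-mono-≤ sparse (ℕ.*-monoˡ-≤ A (ℕ.≤-trans L≤n (ℕ.m≤m+n n (n + 0)))) ⟩
      L * k + 2 * n * A    ≡⟨ cong₂ _+_ refl (ℕ.*-comm (2 * n) A) ⟩
      L * k + A * (2 * n)  ≡⟨ ℕ.+-comm (L * k) _ ⟩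
      A * (2 * n) + L * k  ∎
      where
      sparse : 2 * size Y ≤ L * k
      sparse = ℕ.≤-trans
        (late-rows-sparse 3m≤n (ℕ.≤-trans (labelSumFrom-lower (suc i) Y) cost′) len′)
        (ℕ.m≤m*n L k {{ℕ.>-nonZero 0<k}})

module _ {k A n m : ℕ} where

  CoeffCondition : Vec (Subset k) (suc (2 * n)) → Set
  CoeffCondition w = IsMotzkin k A (suc (2 * n)) w
    × (+ (2 * k * n * (n + 1) + 2 * A * n * (2 * n + 1)) ℤ.- area4 A (+ 0) w ≡ + (4 * m))

  coeffCondition? : ∀ w → Dec (CoeffCondition w)
  coeffCondition? w =
    (All.all? (λ H → + 0 ℤ.≤? H) (heights2 A (+ 0) w) ×-dec (end2 A (+ 0) w ℤ.≟ _)) ×-dec (_ ℤ.≟ _)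

  coeffCondition-irrelevant : ∀ w (p q : CoeffCondition w) → p ≡ q
  coeffCondition-irrelevant w ((nonneg , ends) , deficit) ((nonneg′ , ends′) , deficit′) =
    cong₂ _,_ (cong₂ _,_ (All.irrelevant ℤ.≤-irrelevant nonneg nonneg′) (ℤ-UIP ends ends′))
              (ℤ-UIP deficit deficit′)
    where
    ℤ-UIP : {i j : ℤ} (p q : i ≡ j) → p ≡ q
    ℤ-UIP = Decidable⇒UIP.≡-irrelevant ℤ._≟_

  CMCoeffPaths-≡ : {p q : CMCoeffPaths k A n m} → proj₁ p ≡ proj₁ q → p ≡ q
  CMCoeffPaths-≡ {w , c} {.w , c′} refl = cong (w ,_) (coeffCondition-irrelevant w c c′)

module Correspondence {k A m n : ℕ} (0<k : 0 < k) (2≤k+A : 2 ≤ k + A) (3m≤n : 3 * m ≤ n) where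

  private
    m≤n∸m : m ≤ n ∸ m
    m≤n∸m = ℕ.m+n≤o⇒m≤o∸n m (ℕ.≤-trans (ℕ.+-monoʳ-≤ m (ℕ.m≤m+n m (m + 0))) 3m≤n)
    m≤n : m ≤ n
    m≤n = ℕ.≤-trans m≤n∸m (ℕ.m∸n≤m n m)

  module FromCF (p : CFPart k A m) where
    open CFPart p

    Rt : Vec (Subset k) n
    Rt = table n top
    Rb : Vec (Subset k) (suc (n + 0))
    Rb = table (suc (n + 0)) bottom
    open GluedPath {A = A} Rt Rb public

    rows-Rt : rows Rt ≡ top
    rows-Rt = rows-table n topDec λ z∈ →
      ℕ.≤-trans (∈⇒proj₁<length+sum z∈) (ℕ.≤-trans (ℕ.m≤m+n _ _) (ℕ.≤-trans (ℕ.≤-reflexive weight) m≤n))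
    rows-Rb : rows Rb ≡ bottom
    rows-Rb = rows-table (suc (n + 0)) botDec λ z∈ →
      s≤s (ℕ.≤-trans (∈⇒proj₁≤sum z∈) (ℕ.≤-trans (ℕ.m≤n+m _ _)
            (ℕ.≤-trans (ℕ.≤-reflexive weight) (ℕ.≤-trans m≤n (ℕ.m≤m+n n 0)))))

    balanced : 2 * size Rt + k ≡ A + 2 * size Rb
    balanced = subst₂ (λ r s → 2 * r + k ≡ A + 2 * s)
      (trans (cong length (sym rows-Rt)) (length-rows Rt))
      (trans (cong length (sym rows-Rb)) (length-rows Rb)) rowLen
    weighs : size Rt + labelSum Rt + labelSum Rb ≡ m
    weighs = trans (cong₂ _+_ (cong₂ _+_ r≡ t≡) b≡) weight
      where
      r≡ : size Rt ≡ length top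
      r≡ = trans (sym (length-rows Rt)) (cong length rows-Rt)
      t≡ : labelSum Rt ≡ sum (map proj₁ top)
      t≡ = trans (sym (sum-rows Rt)) (cong (λ L → sum (map proj₁ L)) rows-Rt)
      b≡ : labelSum Rb ≡ sum (map proj₁ bottom)
      b≡ = trans (sym (sum-rows Rb)) (cong (λ L → sum (map proj₁ L)) rows-Rb)

    ends : end2 A (+ 0) path ≡ + (A * (2 * n))
    ends = from ends-at-height balanced

    nonneg : All Nonneg (heights2 A (+ 0) path)
    nonneg = heights-join A (+ 0) (Vec.map ∁ Rt) (reverse Rb)
      (top-nonneg 2≤k+A m Rt 0 top-cost (ℕ.*-monoʳ-≤ 2 (ℕ.≤-trans r≤m m≤n∸m)))
      (bottom-nonneg 0<k 3m≤n 0 (reverse Rb) _ (cong suc (ℕ.+-identityʳ n))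
        (ℕ.≤-trans (ℕ.≤-reflexive (labelSumFrom-reverse Rb)) b≤m)
        (trans (sym (end2-join A (+ 0) (Vec.map ∁ Rt) (reverse Rb))) ends))
      where
      top-cost : size Rt + labelSum Rt ≤ m
      top-cost = ℕ.≤-trans (ℕ.m≤m+n _ (labelSum Rb)) (ℕ.≤-reflexive weighs)
      r≤m : size Rt ≤ m
      r≤m = ℕ.≤-trans (ℕ.m≤m+n _ (labelSum Rt)) top-cost
      b≤m : labelSum Rb ≤ m
      b≤m = ℕ.≤-trans (ℕ.m≤n+m (labelSum Rb) (size Rt + labelSum Rt)) (ℕ.≤-reflexive weighs)

  toPath : CFPart k A m → CMCoeffPaths k A n m
  toPath p = path , (nonneg , ends) , from (deficit-is-weight balanced m) weighs
    where open FromCF p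

  module FromPath (q : CMCoeffPaths k A n m) where
    w : Vec (Subset k) (suc (2 * n))
    w = proj₁ q

    Rt : Vec (Subset k) n
    Rt = Vec.map ∁ (proj₁ (split n w))
    Rb : Vec (Subset k) (suc (n + 0))
    Rb = reverse (proj₂ (split n w))
    open GluedPath {A = A} Rt Rb public

    path≡w : path ≡ w
    path≡w = trans (cong₂ join (map-∁-involutive (proj₁ (split n w)))
                               (Vec.reverse-involutive (proj₂ (split n w))))
                   (join-split n w)

    balanced : 2 * size Rt + k ≡ A + 2 * size Rb
    balanced = to ends-at-height (subst (λ v → end2 A (+ 0) v ≡ _) (sym path≡w) (proj₂ (proj₁ (proj₂ q))))

    weighs : size Rt + labelSum Rt + labelSum Rb ≡ m
    weighs = to (deficit-is-weight balanced m)
      (subst (λ v → + top-area ℤ.- area4 A (+ 0) v ≡ + (4 * m)) (sym path≡w) (proj₂ (proj₂ q)))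

  toCF : CMCoeffPaths k A n m → CFPart k A m
  toCF q = record
    { top    = rows Rt
    ; bottom = rows Rb
    ; topDec = rows-strictDec Rt
    ; botDec = rows-strictDec Rb
    ; rowLen = subst₂ (λ r s → 2 * r + k ≡ A + 2 * s) (sym (length-rows Rt)) (sym (length-rows Rb)) balanced
    ; weight = trans (cong₂ _+_ (cong₂ _+_ (length-rows Rt) (sum-rows Rt)) (sum-rows Rb)) weighs
    }
    where open FromPath q

  private
    CFPart-≡ : ∀ {t t′ b b′ td td′ bd bd′ l l′ w w′} → t ≡ t′ → b ≡ b′ → _≡_ {A = CFPart k A m}
      (record { top = t  ; bottom = b  ; topDec = td  ; botDec = bd  ; rowLen = l  ; weight = w  })
      (record { top = t′ ; bottom = b′ ; topDec = td′ ; botDec = bd′ ; rowLen = l′ ; weight = w′ })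
    CFPart-≡ {td = td} {td′} {bd} {bd′} {l} {l′} {w} {w′} refl refl
      rewrite strictDec-irrelevant td td′ | strictDec-irrelevant bd bd′
            | ℕ.≡-irrelevant l l′ | ℕ.≡-irrelevant w w′ = refl

  toCF∘toPath : ∀ p → toCF (toPath p) ≡ p
  toCF∘toPath p = CFPart-≡
    (begin
      rows (Vec.map ∁ (proj₁ (split n path)))  ≡⟨ cong (λ v → rows (Vec.map ∁ (proj₁ v))) unglue ⟩
      rows (Vec.map ∁ (Vec.map ∁ Rt))          ≡⟨ cong rows (map-∁-involutive Rt) ⟩
      rows Rt                                  ≡⟨ rows-Rt ⟩
      CFPart.top p                             ∎)
    (begin
      rows (reverse (proj₂ (split n path)))    ≡⟨ cong (λ v → rows (reverse (proj₂ v))) unglue ⟩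
      rows (reverse (reverse Rb))              ≡⟨ cong rows (Vec.reverse-involutive Rb) ⟩
      rows Rb                                  ≡⟨ rows-Rb ⟩
      CFPart.bottom p                          ∎)
    where
    open FromCF p
    open ≡-Reasoning
    unglue : split n path ≡ (Vec.map ∁ Rt , reverse Rb)
    unglue = split-join (Vec.map ∁ Rt) (reverse Rb)

  toPath∘toCF : ∀ q → toPath (toCF q) ≡ q
  toPath∘toCF q = CMCoeffPaths-≡ {A = A} {m = m}
    (trans (cong₂ (λ X Y → join (Vec.map ∁ X) (reverse Y)) (table-rows Rt) (table-rows Rb)) path≡w)
    where open FromPath q

  CFPart↔CMCoeffPaths : CFPart k A m ↔ CMCoeffPaths k A n m
  CFPart↔CMCoeffPaths = mk↔ₛ′ toPath toCF toPath∘toCF toCF∘toPath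

CMCoeffPaths-finite : ∀ k A n m → Finite (CMCoeffPaths k A n m)
CMCoeffPaths-finite k A n m =
  Σ-finite (Vec-finite (Vec-finite Bool-finite k) (suc (2 * n))) (CoeffCondition {k} {A} {n} {m})
    (coeffCondition? {k} {A} {n} {m}) (coeffCondition-irrelevant {k} {A} {n} {m})

2≤k+A : ∀ {k A} → 0 < k → A % 2 ≡ k % 2 → 2 ≤ k + A
2≤k+A {suc zero}    {zero}  _ ()
2≤k+A {suc zero}    {suc A} _ _ = s≤s (s≤s z≤n)
2≤k+A {suc (suc k)} {A}     _ _ = s≤s (s≤s z≤n)

theorem3 : (k A : ℕ) → 0 < k → A % 2 ≡ k % 2 →
    (m : ℕ) → Σ ℕ (λ c → (CFPart k A m ↔ Fin c)
      × Σ ℕ (λ n₀ → (n : ℕ) → n₀ ≤ n → CMCoeffPaths k A n m ↔ Fin c))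
theorem3 k A 0<k parity m =
  c , CFPart↔c , 3 * m , λ n 3m≤n → ↔-trans (↔-sym (CFPart↔paths 3m≤n)) CFPart↔c
  where
  CFPart↔paths : ∀ {n} → 3 * m ≤ n → CFPart k A m ↔ CMCoeffPaths k A n m
  CFPart↔paths = Correspondence.CFPart↔CMCoeffPaths 0<k (2≤k+A 0<k parity)
  c : ℕ
  c = proj₁ (CMCoeffPaths-finite k A (3 * m) m)
  CFPart↔c : CFPart k A m ↔ Fin c
  CFPart↔c = ↔-trans (CFPart↔paths ℕ.≤-refl) (proj₂ (CMCoeffPaths-finite k A (3 * m) m))
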